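{- Let $p\geq 5$ be prime. Then all odd numbers $$2k(n,p)^++1=(2n+1)p+4N(p/6),\ n=0,1,2,\ldots,\qquad 2k(n,p)^-+1=(2n+1)p-4N(p/6),\ n=1,2,\ldots$$ are non-ranks. More precisely: (a) if $p\equiv 1\pmod 6$, then $3(2k(n,p)^++1)\pm 2$ is the pair $([3(2n+1)+2]p-4,\,[3(2n+1)+2]p)$ and $3(2k(n,p)^-+1)\pm2$ is the pair $([3(2n+1)-2]p,\,[3(2n+1)-2]p+4)$; (b) if $p\equiv -1\pmod 6$, then $3(2k(n,p)^++1)\pm 2$ is the pair $([3(2n+1)+2]p,\,[3(2n+1)+2]p+4)$ and $3(2k(n,p)^-+1)\pm2$ is the pair $([3(2n+1)-2]p-4,\,[3(2n+1)-2]p)$. Each of these pairs contains a composite number.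
   Context: For real $x$, $N(x)$ denotes the integer nearest to $x$. An odd integer $t\geq 3$ is a twin-4 rank if $3t-2$ and $3t+2$ are both prime, and a non-rank otherwise. -}

module Defs where

open import Data.Nat using (ℕ; suc; _+_; _*_; _∸_; _≤_; NonZero)
open import Data.Nat.DivMod using (_/_; _%_)
open import Data.Nat.Primality using (Prime)
open import Data.Product using (_×_)
open import Relation.Nullary using (¬_)
open import Relation.Binary.PropositionalEquality using (_≡_)

-- N(a/b): the integer nearest to a/b (halves rounded up), i.e. ⌊(2a+b)/(2b)⌋.
-- For a = p prime ≥ 5 and b = 6 no tie occurs, so the rounding convention is irrelevant.
nearest : (a b : ℕ) → .{{NonZero b}} → ℕ
nearest a (suc b) = (2 * a + suc b) / (2 * suc b)

Odd : ℕ → Set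
Odd t = t % 2 ≡ 1

Twin4Rank : ℕ → Set
Twin4Rank t = Odd t × 3 ≤ t × Prime (3 * t ∸ 2) × Prime (3 * t + 2)

NonRank : ℕ → Set
NonRank t = Odd t × 3 ≤ t × ¬ (Prime (3 * t ∸ 2) × Prime (3 * t + 2))

kPlus : ℕ → ℕ → ℕ
kPlus p n = (2 * n + 1) * p + 4 * nearest p 6

-- 2k(n,p)^- + 1 = (2n+1)p - 4N(p/6)   (used for n ≥ 1, where it is positive)
kMinus : ℕ → ℕ → ℕ
kMinus p n = (2 * n + 1) * p ∸ 4 * nearest p 6

{-# OPTIONS --safe #-}
-- A prime p ≥ 5 is 6c + 1 or 6c + 5, with N(p/6) equal to c resp. c + 1, so that
-- 12 N(p/6) = 2p − 2 resp. 2p + 2. Hence for t = (2n+1)p ± 4N(p/6) the number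
-- 3t = 3(2n+1)p ± 12 N(p/6) differs by exactly 2 from the multiple (3(2n+1) ± 2)p of p,
-- so one of 3t − 2, 3t + 2 is a proper multiple of p and t is not a twin-4 rank.
module Submission where

open import Defs
open import Data.Nat using (ℕ; suc; _+_; _*_; _∸_; _≤_; _<_; NonTrivial; s≤s; z≤n)
open import Data.Nat.DivMod using (_%_; _/_; m≡m%n+[m/n]*n; m%n<n; [m+kn]%n≡m%n; m∣n⇒o%n%m≡o%m; +-distrib-/-∣ʳ; m*n/n≡m)
open import Data.Nat.Divisibility using (_∤_; divides; n∣m*n; m%n≡0⇒n∣m)
open import Data.Nat.Primality using (Prime; Composite; composite; prime⇒nonZero; prime⇒nonTrivial; prime⇒¬composite; composite⇒¬prime)
open import Data.Nat.Properties using (+-assoc; ≤-reflexive; m≤m+n; *-comm; *-mono-≤; m<m*n; m≤n+m; m+n∸n≡m; ∸-+-assoc; ≤-trans)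
open import Data.Nat.Tactic.RingSolver using (solve-∀)
open import Data.Product using (_×_; _,_; proj₁; proj₂; ∃)
open import Data.Sum using (_⊎_; inj₁; inj₂)
open import Function using (_∘_)
open import Relation.Nullary using (¬_; contradiction)
open import Relation.Binary.PropositionalEquality using (_≡_; refl; sym; trans; cong; subst; module ≡-Reasoning)

nearest-+-* : ∀ r m b → nearest (r + m * suc b) (suc b) ≡ nearest r (suc b) + m
nearest-+-* r m b = begin
  (2 * (r + m * suc b) + suc b) / (2 * suc b)       ≡⟨ cong (_/ (2 * suc b)) (shift r m b) ⟩
  (2 * r + suc b + m * (2 * suc b)) / (2 * suc b)   ≡⟨ +-distrib-/-∣ʳ (2 * r + suc b) (n∣m*n m) ⟩
  nearest r (suc b) + m * (2 * suc b) / (2 * suc b) ≡⟨ cong (nearest r (suc b) +_) (m*n/n≡m m (2 * suc b)) ⟩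
  nearest r (suc b) + m                             ∎
  where
  open ≡-Reasoning
  shift : ∀ r m b → 2 * (r + m * suc b) + suc b ≡ 2 * r + suc b + m * (2 * suc b)
  shift = solve-∀

prime⇒∤ : ∀ {p} d .{{_ : NonTrivial d}} → Prime p → d < p → d ∤ p
prime⇒∤ d pp d<p d∣p = prime⇒¬composite pp (composite d<p d∣p)

∤2∧∤3⇒%6≡1⊎%6≡5 : ∀ {p} → 2 ∤ p → 3 ∤ p → p % 6 ≡ 1 ⊎ p % 6 ≡ 5
∤2∧∤3⇒%6≡1⊎%6≡5 {p} 2∤p 3∤p
  with p % 6 | m%n<n p 6 | m∣n⇒o%n%m≡o%m 2 6 p (divides 3 refl) | m∣n⇒o%n%m≡o%m 3 6 p (divides 2 refl)
... | 0 | _ | p%2≡0 | _     = contradiction (m%n≡0⇒n∣m p 2 (sym p%2≡0)) 2∤p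
... | 1 | _ | _     | _     = inj₁ refl
... | 2 | _ | p%2≡0 | _     = contradiction (m%n≡0⇒n∣m p 2 (sym p%2≡0)) 2∤p
... | 3 | _ | _     | p%3≡0 = contradiction (m%n≡0⇒n∣m p 3 (sym p%3≡0)) 3∤p
... | 4 | _ | p%2≡0 | _     = contradiction (m%n≡0⇒n∣m p 2 (sym p%2≡0)) 2∤p
... | 5 | _ | _     | _     = inj₂ refl
... | suc (suc (suc (suc (suc (suc _))))) | s≤s (s≤s (s≤s (s≤s (s≤s (s≤s ()))))) | _ | _

prime≥5⇒6c+1⊎6c+5 : ∀ {p} → Prime p → 5 ≤ p →
                     (∃ λ c → p ≡ 1 + c * 6) ⊎ (∃ λ c → p ≡ 5 + c * 6)
prime≥5⇒6c+1⊎6c+5 {p} pp 5≤p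
  with ∤2∧∤3⇒%6≡1⊎%6≡5 (prime⇒∤ 2 pp (≤-trans (s≤s (s≤s (s≤s z≤n))) 5≤p))
                        (prime⇒∤ 3 pp (≤-trans (s≤s (s≤s (s≤s (s≤s z≤n)))) 5≤p))
... | inj₁ p%6≡1 = inj₁ (p / 6 , trans (m≡m%n+[m/n]*n p 6) (cong (_+ p / 6 * 6) p%6≡1))
... | inj₂ p%6≡5 = inj₂ (p / 6 , trans (m≡m%n+[m/n]*n p 6) (cong (_+ p / 6 * 6) p%6≡5))

≡1+n*2⇒odd : ∀ {m} n → m ≡ 1 + n * 2 → Odd m
≡1+n*2⇒odd n refl = [m+kn]%n≡m%n 1 n 2

3[2n+1]∸2≡1+n*6 : ∀ n → 3 * (2 * n + 1) ∸ 2 ≡ 1 + n * 6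
3[2n+1]∸2≡1+n*6 n = trans (cong (_∸ 2) (expand n)) (m+n∸n≡m (1 + n * 6) 2)
  where
  expand : ∀ n → 3 * (2 * n + 1) ≡ 1 + n * 6 + 2
  expand = solve-∀

kPlus-nearest : ∀ {p c} n → nearest p 6 ≡ c → kPlus p n ≡ (2 * n + 1) * p + 4 * c
kPlus-nearest {p} n refl = refl

kMinus-nearest : ∀ {p c k} n → nearest p 6 ≡ c → (2 * n + 1) * p ≡ k + 4 * c → kMinus p n ≡ k
kMinus-nearest {p} {k = k} n refl eq =
  trans (cong (_∸ 4 * nearest p 6) eq) (m+n∸n≡m k (4 * nearest p 6))

kPlus-6c+1 : ∀ c n → kPlus (1 + c * 6) n ≡ 1 + (n * (1 + c * 6) + c * 5) * 2
kPlus-6c+1 c n = trans (kPlus-nearest n (nearest-+-* 1 c 5)) (expand c n)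
  where
  expand : ∀ c n → (2 * n + 1) * (1 + c * 6) + 4 * c ≡ 1 + (n * (1 + c * 6) + c * 5) * 2
  expand = solve-∀

kMinus-6c+1 : ∀ c n → kMinus (1 + c * 6) n ≡ 1 + (n * (1 + c * 6) + c) * 2
kMinus-6c+1 c n = kMinus-nearest n (nearest-+-* 1 c 5) (expand c n)
  where
  expand : ∀ c n → (2 * n + 1) * (1 + c * 6) ≡ 1 + (n * (1 + c * 6) + c) * 2 + 4 * c
  expand = solve-∀

kPlus-6c+5 : ∀ c n → kPlus (5 + c * 6) n ≡ 1 + (n * (5 + c * 6) + 4 + c * 5) * 2
kPlus-6c+5 c n = trans (kPlus-nearest n (nearest-+-* 5 c 5)) (expand c n)
  where
  expand : ∀ c n → (2 * n + 1) * (5 + c * 6) + 4 * (1 + c) ≡ 1 + (n * (5 + c * 6) + 4 + c * 5) * 2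
  expand = solve-∀

kMinus-6c+5 : ∀ c n → kMinus (5 + c * 6) n ≡ 1 + (n * (5 + c * 6) + c) * 2
kMinus-6c+5 c n = kMinus-nearest n (nearest-+-* 5 c 5) (expand c n)
  where
  expand : ∀ c n → (2 * n + 1) * (5 + c * 6) ≡ 1 + (n * (5 + c * 6) + c) * 2 + 4 * (1 + c)
  expand = solve-∀

3kPlus-6c+1 : ∀ c n → 3 * kPlus (1 + c * 6) n + 2 ≡ (3 * (2 * n + 1) + 2) * (1 + c * 6)
3kPlus-6c+1 c n = trans (cong (λ k → 3 * k + 2) (kPlus-6c+1 c n)) (expand c n)
  where
  expand : ∀ c n → 3 * (1 + (n * (1 + c * 6) + c * 5) * 2) + 2 ≡ (3 * (2 * n + 1) + 2) * (1 + c * 6)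
  expand = solve-∀

3kMinus-6c+1 : ∀ c n → 3 * kMinus (1 + c * 6) n ≡ (3 * (2 * n + 1) ∸ 2) * (1 + c * 6) + 2
3kMinus-6c+1 c n = begin
  3 * kMinus (1 + c * 6) n                 ≡⟨ cong (3 *_) (kMinus-6c+1 c n) ⟩
  3 * (1 + (n * (1 + c * 6) + c) * 2)      ≡⟨ expand c n ⟩
  (1 + n * 6) * (1 + c * 6) + 2            ≡⟨ cong (λ a → a * (1 + c * 6) + 2) (3[2n+1]∸2≡1+n*6 n) ⟨
  (3 * (2 * n + 1) ∸ 2) * (1 + c * 6) + 2  ∎
  where
  open ≡-Reasoning
  expand : ∀ c n → 3 * (1 + (n * (1 + c * 6) + c) * 2) ≡ (1 + n * 6) * (1 + c * 6) + 2
  expand = solve-∀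

3kPlus-6c+5 : ∀ c n → 3 * kPlus (5 + c * 6) n ≡ (3 * (2 * n + 1) + 2) * (5 + c * 6) + 2
3kPlus-6c+5 c n = trans (cong (3 *_) (kPlus-6c+5 c n)) (expand c n)
  where
  expand : ∀ c n → 3 * (1 + (n * (5 + c * 6) + 4 + c * 5) * 2) ≡ (3 * (2 * n + 1) + 2) * (5 + c * 6) + 2
  expand = solve-∀

3kMinus-6c+5 : ∀ c n → 3 * kMinus (5 + c * 6) n + 2 ≡ (3 * (2 * n + 1) ∸ 2) * (5 + c * 6)
3kMinus-6c+5 c n = begin
  3 * kMinus (5 + c * 6) n + 2             ≡⟨ cong (λ k → 3 * k + 2) (kMinus-6c+5 c n) ⟩
  3 * (1 + (n * (5 + c * 6) + c) * 2) + 2  ≡⟨ expand c n ⟩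
  (1 + n * 6) * (5 + c * 6)                ≡⟨ cong (_* (5 + c * 6)) (3[2n+1]∸2≡1+n*6 n) ⟨
  (3 * (2 * n + 1) ∸ 2) * (5 + c * 6)      ∎
  where
  open ≡-Reasoning
  expand : ∀ c n → 3 * (1 + (n * (5 + c * 6) + c) * 2) + 2 ≡ (1 + n * 6) * (5 + c * 6)
  expand = solve-∀

-- m is 3t + 2 or 3t − 2; the second case is stated additively to avoid truncated subtraction.
data PairMember (t m : ℕ) : Set where
  upper : 3 * t + 2 ≡ m → PairMember t m
  lower : 3 * t ≡ m + 2 → PairMember t m

upper-pair : ∀ {t m} → 3 * t + 2 ≡ m → (3 * t ∸ 2 ≡ m ∸ 4) × (3 * t + 2 ≡ m)
upper-pair {t} refl =
  sym (trans (sym (∸-+-assoc (3 * t + 2) 2 2)) (cong (_∸ 2) (m+n∸n≡m (3 * t) 2))) , refl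

lower-pair : ∀ {t m} → 3 * t ≡ m + 2 → (3 * t ∸ 2 ≡ m) × (3 * t + 2 ≡ m + 4)
lower-pair {m = m} eq =
  trans (cong (_∸ 2) eq) (m+n∸n≡m m 2) , trans (cong (_+ 2) eq) (+-assoc m 2 2)

member-≤ : ∀ {t m} → PairMember t m → m ≤ 3 * t + 2
member-≤ (upper eq)         = ≤-reflexive (sym eq)
member-≤ {t} {m} (lower eq) = subst (m ≤_) (sym (proj₂ (lower-pair {t} eq))) (m≤m+n m 4)

member-composite : ∀ {t m} → PairMember t m → Composite m →
                   Composite (3 * t ∸ 2) ⊎ Composite (3 * t + 2)
member-composite     (upper eq) c = inj₂ (subst Composite (sym eq) c)
member-composite {t} (lower eq) c = inj₁ (subst Composite (sym (proj₁ (lower-pair {t} eq))) c)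

composite-*prime : ∀ {a p} → 2 ≤ a → Prime p → Composite (a * p)
composite-*prime {a} {p} 2≤a pp = composite (subst (p <_) (*-comm p a) (m<m*n p a 2≤a)) (n∣m*n a)
  where instance
    _ = prime⇒nonTrivial pp
    _ = prime⇒nonZero pp

3≤-of-10≤3t+2 : ∀ t → 10 ≤ 3 * t + 2 → 3 ≤ t
3≤-of-10≤3t+2 0 (s≤s (s≤s ()))
3≤-of-10≤3t+2 1 (s≤s (s≤s (s≤s (s≤s (s≤s ())))))
3≤-of-10≤3t+2 2 (s≤s (s≤s (s≤s (s≤s (s≤s (s≤s (s≤s (s≤s ()))))))))
3≤-of-10≤3t+2 (suc (suc (suc t))) _ = s≤s (s≤s (s≤s z≤n))

WitnessedNonRank : ℕ → Set
WitnessedNonRank t = NonRank t × (Composite (3 * t ∸ 2) ⊎ Composite (3 * t + 2))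

member⇒witnessedNonRank : ∀ {t a p} → Prime p → 5 ≤ p → 2 ≤ a → Odd t → PairMember t (a * p) →
                          WitnessedNonRank t
member⇒witnessedNonRank {t} pp 5≤p 2≤a odd mem =
  (odd , 3≤-of-10≤3t+2 t (≤-trans (*-mono-≤ 2≤a 5≤p) (member-≤ mem)) , not-both composite±2)
  , composite±2
  where
  composite±2 : Composite (3 * t ∸ 2) ⊎ Composite (3 * t + 2)
  composite±2 = member-composite mem (composite-*prime 2≤a pp)
  not-both : ∀ {x y} → Composite x ⊎ Composite y → ¬ (Prime x × Prime y)
  not-both (inj₁ cx) (px , _) = composite⇒¬prime cx px
  not-both (inj₂ cy) (_ , py) = composite⇒¬prime cy py

2≤3[2n+1]+2 : ∀ n → 2 ≤ 3 * (2 * n + 1) + 2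
2≤3[2n+1]+2 n = m≤n+m 2 _

2≤3[2n+1]∸2 : ∀ {n} → 1 ≤ n → 2 ≤ 3 * (2 * n + 1) ∸ 2
2≤3[2n+1]∸2 {n} 1≤n = subst (2 ≤_) (sym (3[2n+1]∸2≡1+n*6 n)) (s≤s (*-mono-≤ 1≤n (s≤s z≤n)))

witnessed-kPlus-6c+1 : ∀ c → Prime (1 + c * 6) → 5 ≤ 1 + c * 6 →
                       ∀ n → WitnessedNonRank (kPlus (1 + c * 6) n)
witnessed-kPlus-6c+1 c pp 5≤p n = member⇒witnessedNonRank pp 5≤p (2≤3[2n+1]+2 n)
  (≡1+n*2⇒odd (n * (1 + c * 6) + c * 5) (kPlus-6c+1 c n)) (upper (3kPlus-6c+1 c n))

witnessed-kMinus-6c+1 : ∀ c → Prime (1 + c * 6) → 5 ≤ 1 + c * 6 →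
                        ∀ n → 1 ≤ n → WitnessedNonRank (kMinus (1 + c * 6) n)
witnessed-kMinus-6c+1 c pp 5≤p n 1≤n = member⇒witnessedNonRank pp 5≤p (2≤3[2n+1]∸2 1≤n)
  (≡1+n*2⇒odd (n * (1 + c * 6) + c) (kMinus-6c+1 c n)) (lower (3kMinus-6c+1 c n))

witnessed-kPlus-6c+5 : ∀ c → Prime (5 + c * 6) → 5 ≤ 5 + c * 6 →
                       ∀ n → WitnessedNonRank (kPlus (5 + c * 6) n)
witnessed-kPlus-6c+5 c pp 5≤p n = member⇒witnessedNonRank pp 5≤p (2≤3[2n+1]+2 n)
  (≡1+n*2⇒odd (n * (5 + c * 6) + 4 + c * 5) (kPlus-6c+5 c n)) (lower (3kPlus-6c+5 c n))

witnessed-kMinus-6c+5 : ∀ c → Prime (5 + c * 6) → 5 ≤ 5 + c * 6 →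
                        ∀ n → 1 ≤ n → WitnessedNonRank (kMinus (5 + c * 6) n)
witnessed-kMinus-6c+5 c pp 5≤p n 1≤n = member⇒witnessedNonRank pp 5≤p (2≤3[2n+1]∸2 1≤n)
  (≡1+n*2⇒odd (n * (5 + c * 6) + c) (kMinus-6c+5 c n)) (upper (3kMinus-6c+5 c n))

lemma2p5 : ∀ p → Prime p → 5 ≤ p →
      ((∀ n → NonRank (kPlus p n))
      × (∀ n → 1 ≤ n → NonRank (kMinus p n)))
    × (p % 6 ≡ 1 →
        (∀ n → (3 * kPlus p n ∸ 2 ≡ (3 * (2 * n + 1) + 2) * p ∸ 4)
             × (3 * kPlus p n + 2 ≡ (3 * (2 * n + 1) + 2) * p))
      × (∀ n → 1 ≤ n → (3 * kMinus p n ∸ 2 ≡ (3 * (2 * n + 1) ∸ 2) * p)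
             × (3 * kMinus p n + 2 ≡ (3 * (2 * n + 1) ∸ 2) * p + 4)))
    × (p % 6 ≡ 5 →
        (∀ n → (3 * kPlus p n ∸ 2 ≡ (3 * (2 * n + 1) + 2) * p)
             × (3 * kPlus p n + 2 ≡ (3 * (2 * n + 1) + 2) * p + 4))
      × (∀ n → 1 ≤ n → (3 * kMinus p n ∸ 2 ≡ (3 * (2 * n + 1) ∸ 2) * p ∸ 4)
             × (3 * kMinus p n + 2 ≡ (3 * (2 * n + 1) ∸ 2) * p)))
    × (∀ n → Composite (3 * kPlus p n ∸ 2) ⊎ Composite (3 * kPlus p n + 2))
    × (∀ n → 1 ≤ n → Composite (3 * kMinus p n ∸ 2) ⊎ Composite (3 * kMinus p n + 2))
lemma2p5 p pp 5≤p with prime≥5⇒6c+1⊎6c+5 pp 5≤p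
... | inj₁ (c , refl) =
    (proj₁ ∘ plus , λ n → proj₁ ∘ minus n)
  , (λ _ → (λ n → upper-pair {kPlus (1 + c * 6) n} (3kPlus-6c+1 c n))
         , (λ n _ → lower-pair {kMinus (1 + c * 6) n} (3kMinus-6c+1 c n)))
  , (λ p%6≡5 → contradiction (trans (sym ([m+kn]%n≡m%n 1 c 6)) p%6≡5) λ ())
  , proj₂ ∘ plus , (λ n → proj₂ ∘ minus n)
  where
  plus : ∀ n → WitnessedNonRank (kPlus (1 + c * 6) n)
  plus = witnessed-kPlus-6c+1 c pp 5≤p
  minus : ∀ n → 1 ≤ n → WitnessedNonRank (kMinus (1 + c * 6) n)
  minus = witnessed-kMinus-6c+1 c pp 5≤p
... | inj₂ (c , refl) =
    (proj₁ ∘ plus , λ n → proj₁ ∘ minus n)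
  , (λ p%6≡1 → contradiction (trans (sym ([m+kn]%n≡m%n 5 c 6)) p%6≡1) λ ())
  , (λ _ → (λ n → lower-pair {kPlus (5 + c * 6) n} (3kPlus-6c+5 c n))
         , (λ n _ → upper-pair {kMinus (5 + c * 6) n} (3kMinus-6c+5 c n)))
  , proj₂ ∘ plus , (λ n → proj₂ ∘ minus n)
  where
  plus : ∀ n → WitnessedNonRank (kPlus (5 + c * 6) n)
  plus = witnessed-kPlus-6c+5 c pp 5≤p
  minus : ∀ n → 1 ≤ n → WitnessedNonRank (kMinus (5 + c * 6) n)
  minus = witnessed-kMinus-6c+5 c pp 5≤p
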